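{- Let $m,n\ge 3$ and let $G=\vec{C}_n\,\square\,\vec{C}_m$, i.e. the digraph with vertex set $\mathbb{Z}_n\times\mathbb{Z}_m$ and arcs $(i,j)\to(i+1,j)$ and $(i,j)\to(i,j+1)$ for all $(i,j)$ (first coordinate modulo $n$, second modulo $m$). The following are equivalent: (i) $G$ is a dextro-nut digraph; (ii) $G$ is a laevo-nut digraph; (iii) $G$ is an ambi-nut digraph; (iv) $mn\equiv 0\pmod 2$ and $\gcd(m,n)=1$.
   Context: A digraph $G$ is a finite nonempty vertex set with a binary relation $\to$. Write $G^+(v)=\{u: v\to u\}$, $G^-(v)=\{u:u\to v\}$. $\operatorname{Ker}G=\{\mathbf{x}\colon V(G)\to\mathbb{R} : \sum_{u\in G^+(v)}\mathbf{x}(u)=0\ \forall v\}$ and $\operatorname{CoKer}G=\{\mathbf{x} : \sum_{u\in G^-(v)}\mathbf{x}(u)=0\ \forall v\}$ (kernels of the adjacency matrix and its transpose). A vector is full if it has no zero entry. $G$ is dextro-nut if $\operatorname{Ker}G$ is one-dimensional and spanned by a full vector; laevo-nut if $\operatorname{CoKer}G$ is one-dimensional and spanned by a full vector; ambi-nut if both hold and $\operatorname{Ker}G$, $\operatorname{CoKer}G$ are spanned by the same vector.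
   Formalization: The vectors $\mathbf{x}$ in $\operatorname{Ker}G$ and $\operatorname{CoKer}G$, and the scalars spanning them, are rational instead of real. -}

module Defs where

open import Data.Nat using (ℕ; zero; suc) renaming (_*_ to _*ℕ_)
open import Data.Nat.DivMod using (_%_; m%n<n)
open import Data.Fin using (Fin; zero; suc; toℕ; fromℕ<; remQuot; _≟_)
open import Data.Bool using (Bool; true; false; if_then_else_; _∧_; _∨_)
open import Data.Product using (Σ; _×_; _,_; proj₁; proj₂; ∃)
open import Data.Rational using (ℚ; 0ℚ; _+_; _*_)
open import Relation.Binary.PropositionalEquality using (_≡_; _≢_)
open import Relation.Nullary.Decidable using (⌊_⌋)

-- A finite digraph with vertex set Fin size and arc relation given as a
-- (decidable) Boolean relation:  arc v u = true  iff  v → u.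
record Digraph : Set where
  field
    size : ℕ
    arc  : Fin size → Fin size → Bool
open Digraph public

-- Vectors x : V(G) → ℚ  (ℚ instead of ℝ)
Vector : Digraph → Set
Vector G = Fin (size G) → ℚ

sumFin : {k : ℕ} → (Fin k → ℚ) → ℚ
sumFin {zero}  f = 0ℚ
sumFin {suc k} f = f zero + sumFin (λ i → f (suc i))

outSum : (G : Digraph) → Vector G → Fin (size G) → ℚ
outSum G x v = sumFin (λ u → if arc G v u then x u else 0ℚ)

inSum : (G : Digraph) → Vector G → Fin (size G) → ℚ
inSum G x v = sumFin (λ u → if arc G u v then x u else 0ℚ)

InKer : (G : Digraph) → Vector G → Set
InKer G x = ∀ v → outSum G x v ≡ 0ℚ

InCoKer : (G : Digraph) → Vector G → Set
InCoKer G x = ∀ v → inSum G x v ≡ 0ℚ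

Full : (G : Digraph) → Vector G → Set
Full G x = ∀ v → x v ≢ 0ℚ

Spans : (G : Digraph) → (Vector G → Set) → Vector G → Set
Spans G S x = S x × (∀ y → S y → Σ ℚ λ c → ∀ v → y v ≡ c * x v)

-- Ker G is one-dimensional and spanned by a full vector
-- (a full vector is nonzero since the vertex set is nonempty in use)
DextroNut : Digraph → Set
DextroNut G = Σ (Vector G) λ x → Full G x × Spans G (InKer G) x

LaevoNut : Digraph → Set
LaevoNut G = Σ (Vector G) λ x → Full G x × Spans G (InCoKer G) x

AmbiNut : Digraph → Set
AmbiNut G = Σ (Vector G) λ x → Full G x × Spans G (InKer G) x × Spans G (InCoKer G) x

sucMod : {n : ℕ} → Fin n → Fin n
sucMod {suc k} i = fromℕ< (m%n<n (suc (toℕ i)) (suc k))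

-- C⃗_n □ C⃗_m : vertices Z_n × Z_m encoded as Fin (n * m) via remQuot
-- (i , j) → (i+1 , j)  and  (i , j) → (i , j+1)
torus : ℕ → ℕ → Digraph
torus n m = record
  { size = n *ℕ m
  ; arc  = λ u v → arcNM (remQuot {n} m u) (remQuot {n} m v)
  }
  where
  arcNM : Fin n × Fin m → Fin n × Fin m → Bool
  arcNM (i , j) (i' , j') =
    (⌊ i' ≟ sucMod i ⌋ ∧ ⌊ j' ≟ j ⌋) ∨ (⌊ i' ≟ i ⌋ ∧ ⌊ j' ≟ sucMod j ⌋)

-- Identify a vector x on ℤₙ × ℤₘ with the doubly periodic function Y (a , b) = x (a mod n , b mod m)
-- on ℕ². Both the kernel and the cokernel condition then say Y (a + 1 , b) + Y (a , b + 1) = 0, so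
-- Ker = CoKer and the three nut notions coincide. Iterating this equation gives
-- Y (a , b) = (−1)^a Y (0 , a + b). If mn is odd, the common period mn of both coordinates yields
-- Y = −Y. If n is even (even m is symmetric), the column f = Y (0 , ·) has the periods n and m:
-- for gcd (m , n) = 1 it is constant, so the kernel is spanned by the full vector (−1)^a; for
-- d = gcd (m , n) > 1 the kernel also contains (−1)^a [d ∣ a + b], which has both zero and nonzero
-- entries.
module Submission where

open import Defs
open import Data.Nat using (ℕ; _≤_; _*_)
open import Data.Nat.Divisibility using (_∣_)
open import Data.Nat.GCD using (gcd)
open import Data.Product using (_×_)
open import Function.Bundles using (_⇔_)
open import Relation.Binary.PropositionalEquality using (_≡_)

open import Data.Bool using (Bool; if_then_else_; _∧_; _∨_)
open import Data.Empty using (⊥-elim)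
open import Data.Fin using (Fin; zero; suc; toℕ; combine; remQuot; _≟_)
open import Data.Fin.Properties
  using (suc-injective; toℕ-injective; toℕ-fromℕ<; toℕ<n; combine-remQuot; remQuot-combine;
         combine-injectiveˡ; combine-injectiveʳ)
open import Data.Nat using (zero; suc; _+_; _≮_; NonZero)
open import Data.Nat.Divisibility
  using (divides; _∣?_; _∣0; ∣-refl; ∣1⇒≡1; ∣m∣n⇒∣m+n; ∣m+n∣m⇒∣n; m∣m*n; n∣m*n)
open import Data.Nat.DivMod
  using (_%_; _/_; _mod_; m≡m%n+[m/n]*n; m%n<n; m<n⇒m%n≡m; n%n≡0; m%n%n≡m%n; %-distribˡ-+;
         %-remove-+ˡ)
open import Data.Nat.GCD using (gcd-GCD; gcd[m,n]∣m; gcd[m,n]∣n; gcd-comm; module Bézout)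
open import Data.Nat.Primality using (prime[2]; euclidsLemma)
import Data.Nat.Properties as NP
open import Data.Product using (Σ; _,_; proj₁; proj₂; map; swap)
open import Data.Rational as ℚ using (ℚ; 0ℚ; 1ℚ; -_; ½)
import Data.Rational.Properties as QP
open import Data.Rational.Solver using (module +-*-Solver)
open import Data.Sum using (inj₁; inj₂; [_,_]′)
open import Function using (_∘_)
open import Function.Bundles using (mk⇔; Equivalence)
open import Function.Construct.Composition using (_⇔-∘_)
open import Function.Construct.Symmetry using (⇔-sym)
open import Relation.Nullary using (¬_; Dec; yes; no; does)
open import Relation.Nullary.Decidable
  using (⌊_⌋; isYes≗does; does-⇔; dec-true; dec-false; decidable-stable)
open import Relation.Binary.PropositionalEquality
  using (_≢_; refl; sym; trans; cong; cong₂; subst; module ≡-Reasoning)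

open import Algebra.Properties.CommutativeSemigroup NP.+-commutativeSemigroup using (x∙yz≈y∙xz)
open import Algebra.Properties.CommutativeMonoid.Sum QP.+-0-commutativeMonoid
  using (sum; sum-cong-≗; ∑-distrib-+; sum-replicate-zero)
open import Algebra.Properties.Ring QP.+-*-ring
  using (-‿involutive; -‿distribˡ-*; +-inverseˡ-unique; -1*x≈-x)

x≡-x⇒x≡0 : ∀ {x} → x ≡ - x → x ≡ 0ℚ
x≡-x⇒x≡0 {x} x≡-x = begin
  x                  ≡⟨ solve 1 (λ x → x := (x :+ x) :* con ½) refl x ⟩
  (x ℚ.+ x) ℚ.* ½    ≡⟨ cong (λ y → (x ℚ.+ y) ℚ.* ½) x≡-x ⟩
  (x ℚ.+ - x) ℚ.* ½  ≡⟨ cong (ℚ._* ½) (QP.+-inverseʳ x) ⟩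
  0ℚ                 ∎
  where open ≡-Reasoning
        open +-*-Solver

−1^ : ℕ → ℚ
−1^ zero    = 1ℚ
−1^ (suc k) = - −1^ k

−1^-+2 : ∀ k → −1^ (2 + k) ≡ −1^ k
−1^-+2 k = -‿involutive (−1^ k)

−1^-even-+ : ∀ {n} → 2 ∣ n → ∀ a → −1^ (n + a) ≡ −1^ a
−1^-even-+ (divides zero    refl) a = refl
−1^-even-+ (divides (suc q) refl) a = trans (−1^-+2 (q * 2 + a)) (−1^-even-+ (divides q refl) a)

−1^-even : ∀ {n} → 2 ∣ n → −1^ n ≡ 1ℚ
−1^-even {n} 2∣n = trans (cong −1^ (sym (NP.+-identityʳ n))) (−1^-even-+ 2∣n 0)

−1^-odd : ∀ {n} → ¬ 2 ∣ n → −1^ n ≡ - 1ℚ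
−1^-odd {zero}        2∤0   = ⊥-elim (2∤0 (2 ∣0))
−1^-odd {suc zero}    _     = refl
−1^-odd {suc (suc n)} 2∤2+n = trans (−1^-+2 n) (−1^-odd (2∤2+n ∘ ∣m∣n⇒∣m+n ∣-refl))

−1^≢0 : ∀ k → −1^ k ≢ 0ℚ
−1^≢0 zero          ()
−1^≢0 (suc zero)    ()
−1^≢0 (suc (suc k)) = −1^≢0 k ∘ trans (sym (−1^-+2 k))

Periodic : {A : Set} → ℕ → (ℕ → A) → Set
Periodic p f = ∀ a → f (p + a) ≡ f a

module _ {A : Set} {f : ℕ → A} where

  periodic-*+ : ∀ {p} → Periodic p f → ∀ q a → f (q * p + a) ≡ f a
  periodic-*+     per zero    a = refl
  periodic-*+ {p} per (suc q) a =
    trans (cong f (NP.+-assoc p (q * p) a)) (trans (per (q * p + a)) (periodic-*+ per q a))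

  periodic-∣ : ∀ {p N} → p ∣ N → Periodic p f → Periodic N f
  periodic-∣ (divides q refl) per = periodic-*+ per q

  periodic-% : ∀ {p} .{{_ : NonZero p}} → Periodic p f → ∀ a → f (a % p) ≡ f a
  periodic-% {p} per a = begin
    f (a % p)              ≡⟨ periodic-*+ per (a / p) (a % p) ⟨
    f (a / p * p + a % p)  ≡⟨ cong f (NP.+-comm (a / p * p) (a % p)) ⟩
    f (a % p + a / p * p)  ≡⟨ cong f (m≡m%n+[m/n]*n a p) ⟨
    f a                    ∎
    where open ≡-Reasoning

  periodic-bézout : ∀ {p q d} x y → Periodic p f → Periodic q f →
                    d + y * q ≡ x * p → Periodic d f
  periodic-bézout {p} {q} {d} x y per-p per-q eq a = begin
    f (d + a)            ≡⟨ periodic-*+ per-q y (d + a) ⟨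
    f (y * q + (d + a))  ≡⟨ cong f (x∙yz≈y∙xz (y * q) d a) ⟩
    f (d + (y * q + a))  ≡⟨ cong f (NP.+-assoc d (y * q) a) ⟨
    f (d + y * q + a)    ≡⟨ cong (λ k → f (k + a)) eq ⟩
    f (x * p + a)        ≡⟨ periodic-*+ per-p x a ⟩
    f a                  ∎
    where open ≡-Reasoning

  periodic-gcd : ∀ {p q} → Periodic p f → Periodic q f → Periodic (gcd p q) f
  periodic-gcd {p} {q} per-p per-q with Bézout.identity (gcd-GCD p q)
  ... | Bézout.+- x y eq = periodic-bézout x y per-p per-q eq
  ... | Bézout.-+ x y eq = periodic-bézout y x per-q per-p eq

  periodic-1⇒constant : Periodic 1 f → ∀ a → f a ≡ f 0
  periodic-1⇒constant per zero    = refl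
  periodic-1⇒constant per (suc a) = trans (per a) (periodic-1⇒constant per a)

_spans_ : {I : Set} → (I → ℚ) → ((I → ℚ) → Set) → Set
x spans S = S x × (∀ y → S y → Σ ℚ λ c → ∀ i → y i ≡ c ℚ.* x i)

-- DextroNut G and LaevoNut G unfold to NutSpace (Fin (size G)) (InKer G) and (InCoKer G).
NutSpace : (I : Set) → ((I → ℚ) → Set) → Set
NutSpace I S = Σ (I → ℚ) λ x → (∀ i → x i ≢ 0ℚ) × x spans S

spans-cong : {I : Set} {S T : (I → ℚ) → Set} → (∀ x → S x ⇔ T x) →
             ∀ {x} → x spans S → x spans T
spans-cong S⇔T (Sx , span) =
  Equivalence.to (S⇔T _) Sx , λ y Ty → span y (Equivalence.from (S⇔T y) Ty)

NutSpace-cong : {I : Set} {S T : (I → ℚ) → Set} → (∀ x → S x ⇔ T x) →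
                NutSpace I S ⇔ NutSpace I T
NutSpace-cong S⇔T = mk⇔ (λ (x , full , x-spans) → x , full , spans-cong S⇔T x-spans)
                        (λ (x , full , x-spans) → x , full , spans-cong (⇔-sym ∘ S⇔T) x-spans)

NutSpace-transfer : {I J : Set} (φ : I → J) (σ : J → I) → (∀ j → φ (σ j) ≡ j) →
  {S : (J → ℚ) → Set} {T : (I → ℚ) → Set} →
  (∀ x → S x → T (x ∘ φ)) → (∀ Y → T Y → S (Y ∘ σ)) →
  (∀ Y → T Y → ∀ i → Y (σ (φ i)) ≡ Y i) →
  NutSpace J S ⇔ NutSpace I T
NutSpace-transfer φ σ φ∘σ≗id pull push invariant = mk⇔
  (λ (x , full , Sx , span) → x ∘ φ , full ∘ φ , pull x Sx , λ Y TY →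
     let c , Y∘σ≗cx = span (Y ∘ σ) (push Y TY) in
     c , λ i → trans (sym (invariant Y TY i)) (Y∘σ≗cx (φ i)))
  (λ (Y , full , TY , span) → Y ∘ σ , full ∘ σ , push Y TY , λ y Sy →
     let c , y∘φ≗cY = span (y ∘ φ) (pull y Sy) in
     c , λ j → trans (cong y (sym (φ∘σ≗id j))) (y∘φ≗cY (σ j)))

NutSpace-nonzero-everywhere : ∀ {I S} → NutSpace I S →
                              ∀ {y} → S y → ∀ {i} → y i ≡ 1ℚ → ∀ j → y j ≢ 0ℚ
NutSpace-nonzero-everywhere (x , full , _ , span) Sy {i} yi≡1 j yj≡0 = full j (begin
  x j                  ≡⟨ QP.*-identityˡ (x j) ⟨
  1ℚ ℚ.* x j           ≡⟨ cong (ℚ._* x j) (trans (sym yi≡1) (y≗cx i)) ⟩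
  c ℚ.* x i ℚ.* x j    ≡⟨ solve 3 (λ c u v → c :* u :* v := u :* (c :* v)) refl c (x i) (x j) ⟩
  x i ℚ.* (c ℚ.* x j)  ≡⟨ cong (x i ℚ.*_) (trans (sym (y≗cx j)) yj≡0) ⟩
  x i ℚ.* 0ℚ           ≡⟨ QP.*-zeroʳ (x i) ⟩
  0ℚ                   ∎)
  where open ≡-Reasoning
        open +-*-Solver
        c = proj₁ (span _ Sy)
        y≗cx = proj₂ (span _ Sy)

KernelEq : (ℕ × ℕ → ℚ) → Set
KernelEq Y = ∀ a b → Y (suc a , b) ℚ.+ Y (a , suc b) ≡ 0ℚ

Biperiodic : ℕ → ℕ → (ℕ × ℕ → ℚ) → Set
Biperiodic n m Y = (∀ b → Periodic n (λ a → Y (a , b))) × (∀ a → Periodic m (λ b → Y (a , b)))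

GridKer : ℕ → ℕ → (ℕ × ℕ → ℚ) → Set
GridKer n m Y = KernelEq Y × Biperiodic n m Y

kernelEq-cong : ∀ {Y Z} → (∀ p → Y p ≡ Z p) → KernelEq Y → KernelEq Z
kernelEq-cong Y≗Z KY a b = trans (sym (cong₂ ℚ._+_ (Y≗Z _) (Y≗Z _))) (KY a b)

gridKer-swap : ∀ {n m Y} → GridKer n m Y → GridKer m n (Y ∘ swap)
gridKer-swap {Y = Y} (KY , per₁ , per₂) =
  (λ a b → trans (QP.+-comm (Y (b , suc a)) (Y (suc b , a))) (KY b a)) , per₂ , per₁

kernelEq-shift : ∀ {Y} → KernelEq Y → ∀ k a b → Y (k + a , b) ≡ −1^ k ℚ.* Y (a , k + b)
kernelEq-shift KY zero    a b = sym (QP.*-identityˡ _)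
kernelEq-shift {Y} KY (suc k) a b = begin
  Y (suc (k + a) , b)                ≡⟨ +-inverseˡ-unique _ _ (KY (k + a) b) ⟩
  - Y (k + a , suc b)                ≡⟨ cong -_ (kernelEq-shift {Y} KY k a (suc b)) ⟩
  - (−1^ k ℚ.* Y (a , k + suc b))    ≡⟨ -‿distribˡ-* (−1^ k) _ ⟩
  −1^ (suc k) ℚ.* Y (a , k + suc b)  ≡⟨ cong (λ c → −1^ (suc k) ℚ.* Y (a , c)) (NP.+-suc k b) ⟩
  −1^ (suc k) ℚ.* Y (a , suc k + b)  ∎
  where open ≡-Reasoning

alternating : (ℕ → ℚ) → ℕ × ℕ → ℚ
alternating f (a , b) = −1^ a ℚ.* f (a + b)

kernelEq⇒alternating : ∀ {Y} → KernelEq Y →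
                       ∀ a b → Y (a , b) ≡ alternating (λ k → Y (0 , k)) (a , b)
kernelEq⇒alternating {Y} KY a b =
  trans (cong (λ c → Y (c , b)) (sym (NP.+-identityʳ a))) (kernelEq-shift {Y} KY a 0 b)

alternating-kernelEq : ∀ f → KernelEq (alternating f)
alternating-kernelEq f a b = begin
  - s ℚ.* t ℚ.+ s ℚ.* f (a + suc b)  ≡⟨ cong (λ c → - s ℚ.* t ℚ.+ s ℚ.* f c) (NP.+-suc a b) ⟩
  - s ℚ.* t ℚ.+ s ℚ.* t              ≡⟨ solve 2 (λ s t → (:- s) :* t :+ s :* t := con 0ℚ) refl s t ⟩
  0ℚ                                 ∎
  where open ≡-Reasoning
        open +-*-Solver
        s = −1^ a
        t = f (suc (a + b))

alternating-biperiodic : ∀ {n m f} → 2 ∣ n → Periodic n f → Periodic m f →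
                         Biperiodic n m (alternating f)
alternating-biperiodic {n} {m} {f} 2∣n per-n per-m =
  (λ b a → cong₂ ℚ._*_ (−1^-even-+ 2∣n a) (trans (cong f (NP.+-assoc n a b)) (per-n (a + b)))) ,
  (λ a b → cong (−1^ a ℚ.*_) (trans (cong f (x∙yz≈y∙xz a m b)) (per-m (a + b))))

gridKer-odd⇒zero : ∀ {n m Y} → GridKer n m Y → ¬ 2 ∣ m * n → ∀ a b → Y (a , b) ≡ 0ℚ
gridKer-odd⇒zero {n} {m} {Y} (KY , per₁ , per₂) odd a b = x≡-x⇒x≡0 (begin
  Y (a , b)                          ≡⟨ periodic-∣ (n∣m*n m) (per₁ b) a ⟨
  Y (m * n + a , b)                  ≡⟨ kernelEq-shift {Y} KY (m * n) a b ⟩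
  −1^ (m * n) ℚ.* Y (a , m * n + b)  ≡⟨ cong₂ ℚ._*_ (−1^-odd odd) (periodic-∣ (m∣m*n n) (per₂ a) b) ⟩
  - 1ℚ ℚ.* Y (a , b)                 ≡⟨ -1*x≈-x (Y (a , b)) ⟩
  - Y (a , b)                        ∎)
  where open ≡-Reasoning

gridKer-even-coprime⇒−1^-multiple : ∀ {n m Y} → GridKer n m Y → 2 ∣ n → gcd n m ≡ 1 →
                                    ∀ a b → Y (a , b) ≡ −1^ a ℚ.* Y (0 , 0)
gridKer-even-coprime⇒−1^-multiple {n} {m} {Y} (KY , per₁ , per₂) 2∣n coprime a b = begin
  Y (a , b)             ≡⟨ kernelEq⇒alternating {Y} KY a b ⟩
  −1^ a ℚ.* f (a + b)   ≡⟨ cong (−1^ a ℚ.*_) (periodic-1⇒constant f-periodic-1 (a + b)) ⟩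
  −1^ a ℚ.* f 0         ∎
  where
  open ≡-Reasoning
  f : ℕ → ℚ
  f k = Y (0 , k)
  f-periodic-n : Periodic n f
  f-periodic-n k = begin
    f (n + k)                 ≡⟨ QP.*-identityˡ _ ⟨
    1ℚ ℚ.* f (n + k)          ≡⟨ cong (ℚ._* f (n + k)) (−1^-even 2∣n) ⟨
    −1^ n ℚ.* Y (0 , n + k)   ≡⟨ kernelEq-shift {Y} KY n 0 k ⟨
    Y (n + 0 , k)             ≡⟨ per₁ k 0 ⟩
    f k                       ∎
  f-periodic-1 : Periodic 1 f
  f-periodic-1 = subst (λ d → Periodic d f) coprime (periodic-gcd f-periodic-n (per₂ 0))

even-coprime⇒gridNut : ∀ {n m} → 2 ∣ n → gcd n m ≡ 1 → NutSpace (ℕ × ℕ) (GridKer n m)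
even-coprime⇒gridNut {n} {m} 2∣n coprime = Y , nonzero , Y∈ , span
  where
  one : ℕ → ℚ
  one _ = 1ℚ
  Y : ℕ × ℕ → ℚ
  Y = alternating one
  Y∈ : GridKer n m Y
  Y∈ = alternating-kernelEq one , alternating-biperiodic {n} {m} {one} 2∣n (λ _ → refl) (λ _ → refl)
  nonzero : ∀ p → Y p ≢ 0ℚ
  nonzero (a , _) = −1^≢0 a ∘ trans (sym (QP.*-identityʳ (−1^ a)))
  span : ∀ Z → GridKer n m Z → Σ ℚ λ c → ∀ p → Z p ≡ c ℚ.* Y p
  span Z Z∈ = Z (0 , 0) , λ (a , b) → begin
    Z (a , b)                      ≡⟨ gridKer-even-coprime⇒−1^-multiple {Y = Z} Z∈ 2∣n coprime a b ⟩
    −1^ a ℚ.* Z (0 , 0)            ≡⟨ QP.*-comm (−1^ a) (Z (0 , 0)) ⟩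
    Z (0 , 0) ℚ.* −1^ a            ≡⟨ cong (Z (0 , 0) ℚ.*_) (QP.*-identityʳ (−1^ a)) ⟨
    Z (0 , 0) ℚ.* (−1^ a ℚ.* 1ℚ)   ∎
    where open ≡-Reasoning

multiplesOf : ℕ → ℕ → ℚ
multiplesOf d k = if does (d ∣? k) then 1ℚ else 0ℚ

multiplesOf-periodic : ∀ {d p} → d ∣ p → Periodic p (multiplesOf d)
multiplesOf-periodic {d} {p} d∣p k =
  cong (λ t → if t then 1ℚ else 0ℚ) (does-⇔ d∣p+k⇔d∣k (d ∣? (p + k)) (d ∣? k))
  where d∣p+k⇔d∣k = mk⇔ (λ d∣p+k → ∣m+n∣m⇒∣n d∣p+k d∣p) (∣m∣n⇒∣m+n d∣p)

gridNut-even⇒coprime : ∀ {n m} → 2 ∣ n → NutSpace (ℕ × ℕ) (GridKer n m) → gcd n m ≡ 1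
gridNut-even⇒coprime {n} {m} 2∣n nut = decidable-stable (d NP.≟ 1) λ d≢1 →
  NutSpace-nonzero-everywhere nut W∈ {0 , 0} W[0,0]≡1 (0 , 1) (W[0,1]≡0 (d≢1 ∘ ∣1⇒≡1))
  where
  d = gcd n m
  W : ℕ × ℕ → ℚ
  W = alternating (multiplesOf d)
  W∈ : GridKer n m W
  W∈ = alternating-kernelEq (multiplesOf d) ,
       alternating-biperiodic {f = multiplesOf d} 2∣n (multiplesOf-periodic (gcd[m,n]∣m n m))
                                                      (multiplesOf-periodic (gcd[m,n]∣n n m))
  W[0,0]≡1 : W (0 , 0) ≡ 1ℚ
  W[0,0]≡1 = cong (λ t → 1ℚ ℚ.* (if t then 1ℚ else 0ℚ)) (dec-true (d ∣? 0) (d ∣0))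
  W[0,1]≡0 : ¬ d ∣ 1 → W (0 , 1) ≡ 0ℚ
  W[0,1]≡0 d∤1 = cong (λ t → 1ℚ ℚ.* (if t then 1ℚ else 0ℚ)) (dec-false (d ∣? 1) d∤1)

gridNut⇒even : ∀ {n m} → NutSpace (ℕ × ℕ) (GridKer n m) → 2 ∣ m * n
gridNut⇒even {n} {m} (Y , nonzero , Y∈ , _) =
  decidable-stable (2 ∣? m * n) λ odd → nonzero (0 , 0) (gridKer-odd⇒zero {Y = Y} Y∈ odd 0 0)

gridNut-swap : ∀ {n m} → NutSpace (ℕ × ℕ) (GridKer n m) ⇔ NutSpace (ℕ × ℕ) (GridKer m n)
gridNut-swap =
  NutSpace-transfer swap swap (λ _ → refl) (λ _ → gridKer-swap) (λ _ → gridKer-swap) (λ _ _ _ → refl)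

gridNut⇔even-coprime : ∀ {n m} → NutSpace (ℕ × ℕ) (GridKer n m) ⇔ (2 ∣ m * n × gcd m n ≡ 1)
gridNut⇔even-coprime {n} {m} = mk⇔ to from
  where
  to : NutSpace (ℕ × ℕ) (GridKer n m) → 2 ∣ m * n × gcd m n ≡ 1
  to nut with euclidsLemma m n prime[2] (gridNut⇒even nut)
  ... | inj₁ 2∣m = gridNut⇒even nut , gridNut-even⇒coprime 2∣m (Equivalence.to gridNut-swap nut)
  ... | inj₂ 2∣n = gridNut⇒even nut , trans (gcd-comm m n) (gridNut-even⇒coprime 2∣n nut)
  from : 2 ∣ m * n × gcd m n ≡ 1 → NutSpace (ℕ × ℕ) (GridKer n m)
  from (2∣mn , coprime) with euclidsLemma m n prime[2] 2∣mn
  ... | inj₁ 2∣m = Equivalence.from gridNut-swap (even-coprime⇒gridNut 2∣m coprime)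
  ... | inj₂ 2∣n = even-coprime⇒gridNut 2∣n (trans (gcd-comm n m) coprime)

sumFin≡sum : ∀ {k} (f : Fin k → ℚ) → sumFin f ≡ sum f
sumFin≡sum {zero}  f = refl
sumFin≡sum {suc k} f = cong (f zero ℚ.+_) (sumFin≡sum (f ∘ suc))

⌊⌋-⇔ : {A B : Set} → A ⇔ B → (a? : Dec A) (b? : Dec B) → ⌊ a? ⌋ ≡ ⌊ b? ⌋
⌊⌋-⇔ A⇔B a? b? = trans (isYes≗does a?) (trans (does-⇔ A⇔B a? b?) (sym (isYes≗does b?)))

sum-indicator : ∀ {k} (A : Fin k) (x : Fin k → ℚ) → sum (λ u → if ⌊ u ≟ A ⌋ then x u else 0ℚ) ≡ x A
sum-indicator {suc k} zero    x =
  trans (cong (x zero ℚ.+_) (sum-replicate-zero k)) (QP.+-identityʳ (x zero))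
sum-indicator {suc k} (suc A) x =
  trans (QP.+-identityˡ _) (trans (sum-cong-≗ suc≟suc) (sum-indicator A (x ∘ suc)))
  where
  suc≟suc : ∀ u → (if ⌊ suc u ≟ suc A ⌋ then x (suc u) else 0ℚ) ≡ (if ⌊ u ≟ A ⌋ then x (suc u) else 0ℚ)
  suc≟suc u = cong (λ b → if b then x (suc u) else 0ℚ)
                   (⌊⌋-⇔ (mk⇔ suc-injective (cong suc)) (suc u ≟ suc A) (u ≟ A))

sumFin-pair : ∀ {k} {A B : Fin k} → A ≢ B →
              (t : Fin k → Bool) → (∀ u → t u ≡ ⌊ u ≟ A ⌋ ∨ ⌊ u ≟ B ⌋) →
              ∀ x → sumFin (λ u → if t u then x u else 0ℚ) ≡ x A ℚ.+ x B
sumFin-pair {k} {A} {B} A≢B t t≗A∨B x = begin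
  sumFin (λ u → if t u then x u else 0ℚ)  ≡⟨ sumFin≡sum (λ u → if t u then x u else 0ℚ) ⟩
  sum (λ u → if t u then x u else 0ℚ)     ≡⟨ sum-cong-≗ split ⟩
  sum (λ u → x-at A u ℚ.+ x-at B u)       ≡⟨ ∑-distrib-+ (x-at A) (x-at B) ⟩
  sum (x-at A) ℚ.+ sum (x-at B)           ≡⟨ cong₂ ℚ._+_ (sum-indicator A x) (sum-indicator B x) ⟩
  x A ℚ.+ x B                             ∎
  where
  open ≡-Reasoning
  x-at : Fin k → Fin k → ℚ
  x-at C u = if ⌊ u ≟ C ⌋ then x u else 0ℚ
  split : ∀ u → (if t u then x u else 0ℚ) ≡ x-at A u ℚ.+ x-at B u
  split u rewrite t≗A∨B u with u ≟ A | u ≟ B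
  ... | yes refl | yes refl = ⊥-elim (A≢B refl)
  ... | yes _    | no _     = sym (QP.+-identityʳ (x u))
  ... | no _     | yes _    = sym (QP.+-identityˡ (x u))
  ... | no _     | no _     = refl

≟-sym : ∀ {k} (x y : Fin k) → ⌊ x ≟ y ⌋ ≡ ⌊ y ≟ x ⌋
≟-sym x y = ⌊⌋-⇔ (mk⇔ sym sym) (x ≟ y) (y ≟ x)

combine-≟ : ∀ {n m} (i i′ : Fin n) (j j′ : Fin m) →
            ⌊ combine i j ≟ combine i′ j′ ⌋ ≡ ⌊ i ≟ i′ ⌋ ∧ ⌊ j ≟ j′ ⌋
combine-≟ i i′ j j′ with combine i j ≟ combine i′ j′ | i ≟ i′ | j ≟ j′
... | yes _   | yes _    | yes _    = refl
... | yes ij≡ | no i≢i′  | _        = ⊥-elim (i≢i′ (combine-injectiveˡ i j i′ j′ ij≡))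
... | yes ij≡ | yes _    | no j≢j′  = ⊥-elim (j≢j′ (combine-injectiveʳ i j i′ j′ ij≡))
... | no ij≢  | yes refl | yes refl = ⊥-elim (ij≢ refl)
... | no _    | no _     | _        = refl
... | no _    | yes _    | no _     = refl

combine-elim : ∀ {n m} {P : Fin (n * m) → Set} → (∀ i j → P (combine i j)) → ∀ u → P u
combine-elim {n} {m} {P} P-combine u =
  subst P (combine-remQuot {n} m u) (P-combine (proj₁ (remQuot {n} m u)) (proj₂ (remQuot {n} m u)))

toℕ-mod : ∀ a {N} .{{_ : NonZero N}} → toℕ (a mod N) ≡ a % N
toℕ-mod a {N} = toℕ-fromℕ< (m%n<n a N)

mod-cong : ∀ a b {N} .{{_ : NonZero N}} → a % N ≡ b % N → a mod N ≡ b mod N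
mod-cong a b a%N≡b%N = toℕ-injective (trans (toℕ-mod a) (trans a%N≡b%N (sym (toℕ-mod b))))

mod-toℕ : ∀ {N} .{{_ : NonZero N}} (i : Fin N) → toℕ i mod N ≡ i
mod-toℕ i = toℕ-injective (trans (toℕ-mod (toℕ i)) (m<n⇒m%n≡m (toℕ<n i)))

mod-periodic : ∀ {N} .{{_ : NonZero N}} → Periodic N (_mod N)
mod-periodic {N} a = mod-cong (N + a) a (%-remove-+ˡ a (∣-refl {N}))

[m+n%d]mod≡[m+n]mod : ∀ m n d .{{_ : NonZero d}} → (m + n % d) mod d ≡ (m + n) mod d
[m+n%d]mod≡[m+n]mod m n d = mod-cong (m + n % d) (m + n) (begin
  (m + n % d) % d          ≡⟨ %-distribˡ-+ m (n % d) d ⟩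
  (m % d + n % d % d) % d  ≡⟨ cong (λ k → (m % d + k) % d) (m%n%n≡m%n n d) ⟩
  (m % d + n % d) % d      ≡⟨ %-distribˡ-+ m n d ⟨
  (m + n) % d              ∎)
  where open ≡-Reasoning

sucMod-mod : ∀ {k} a → sucMod (a mod suc k) ≡ suc a mod suc k
sucMod-mod {k} a = trans (cong (λ r → suc r mod suc k) (toℕ-mod a)) ([m+n%d]mod≡[m+n]mod 1 a (suc k))

sucMod-injective : ∀ {k} {i j : Fin (suc k)} → sucMod i ≡ sucMod j → i ≡ j
sucMod-injective {k} {i} {j} si≡sj =
  trans (sym (predMod∘sucMod i)) (trans (cong predMod si≡sj) (predMod∘sucMod j))
  where
  predMod : Fin (suc k) → Fin (suc k)
  predMod i = (k + toℕ i) mod suc k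
  predMod∘sucMod : ∀ i → predMod (sucMod i) ≡ i
  predMod∘sucMod i = begin
    (k + toℕ (suc (toℕ i) mod suc k)) mod suc k  ≡⟨ cong (λ r → (k + r) mod suc k) (toℕ-mod (suc (toℕ i))) ⟩
    (k + suc (toℕ i) % suc k) mod suc k          ≡⟨ [m+n%d]mod≡[m+n]mod k (suc (toℕ i)) (suc k) ⟩
    (k + suc (toℕ i)) mod suc k                  ≡⟨ cong (_mod suc k) (NP.+-suc k (toℕ i)) ⟩
    (suc k + toℕ i) mod suc k                    ≡⟨ mod-periodic (toℕ i) ⟩
    toℕ i mod suc k                              ≡⟨ mod-toℕ i ⟩
    i                                            ∎
    where open ≡-Reasoning

sucMod-≟ : ∀ {k} (i j : Fin (suc k)) → ⌊ sucMod i ≟ sucMod j ⌋ ≡ ⌊ j ≟ i ⌋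
sucMod-≟ i j = ⌊⌋-⇔ (mk⇔ (sym ∘ sucMod-injective) (cong sucMod ∘ sym)) (sucMod i ≟ sucMod j) (j ≟ i)

sucMod≢id : ∀ {k} → 1 ≤ k → (i : Fin (suc k)) → sucMod i ≢ i
sucMod≢id {k} 1≤k i si≡i = [ 1+i≮N , 0≢k ∘ 0≡k ]′ (NP.m≤n⇒m<n∨m≡n (toℕ<n i))
  where
  N = suc k
  [1+i]%N≡i : suc (toℕ i) % N ≡ toℕ i
  [1+i]%N≡i = trans (sym (toℕ-mod (suc (toℕ i)))) (cong toℕ si≡i)
  1+i≮N : suc (toℕ i) ≮ N
  1+i≮N 1+i<N = NP.1+n≢n (trans (sym (m<n⇒m%n≡m 1+i<N)) [1+i]%N≡i)
  0≡k : suc (toℕ i) ≡ N → 0 ≡ k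
  0≡k 1+i≡N = begin
    0                   ≡⟨ n%n≡0 N ⟨
    N % N               ≡⟨ cong (_% N) 1+i≡N ⟨
    suc (toℕ i) % N     ≡⟨ [1+i]%N≡i ⟩
    toℕ i               ≡⟨ NP.suc-injective 1+i≡N ⟩
    k                   ∎
    where open ≡-Reasoning
  0≢k : 0 ≢ k
  0≢k = NP.<⇒≢ 1≤k

module Torus (n′ m′ : ℕ) (1≤n′ : 1 ≤ n′) where

  n m : ℕ
  n = suc n′
  m = suc m′

  G : Digraph
  G = torus n m

  -- the arc relation of torus n m, which Defs only defines locally
  adjacent : Fin n × Fin m → Fin n × Fin m → Bool
  adjacent (i , j) (i′ , j′) = (⌊ i′ ≟ sucMod i ⌋ ∧ ⌊ j′ ≟ j ⌋) ∨ (⌊ i′ ≟ i ⌋ ∧ ⌊ j′ ≟ sucMod j ⌋)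

  arc-combine : ∀ (i i′ : Fin n) (j j′ : Fin m) →
                arc G (combine i j) (combine i′ j′) ≡ adjacent (i , j) (i′ , j′)
  arc-combine i i′ j j′ = cong₂ adjacent (remQuot-combine i j) (remQuot-combine i′ j′)

  arc-from : ∀ (i : Fin n) (j : Fin m) u →
             arc G (combine i j) u ≡ ⌊ u ≟ combine (sucMod i) j ⌋ ∨ ⌊ u ≟ combine i (sucMod j) ⌋
  arc-from i j = combine-elim λ i′ j′ → trans (arc-combine i i′ j j′)
    (sym (cong₂ _∨_ (combine-≟ i′ (sucMod i) j′ j) (combine-≟ i′ i j′ (sucMod j))))

  arc-into : ∀ (i : Fin n) (j : Fin m) u →
             arc G u (combine (sucMod i) (sucMod j))
               ≡ ⌊ u ≟ combine i (sucMod j) ⌋ ∨ ⌊ u ≟ combine (sucMod i) j ⌋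
  arc-into i j = combine-elim λ i′ j′ → begin
    arc G (combine i′ j′) (combine (sucMod i) (sucMod j))
      ≡⟨ arc-combine i′ (sucMod i) j′ (sucMod j) ⟩
    (⌊ sucMod i ≟ sucMod i′ ⌋ ∧ ⌊ sucMod j ≟ j′ ⌋) ∨ (⌊ sucMod i ≟ i′ ⌋ ∧ ⌊ sucMod j ≟ sucMod j′ ⌋)
      ≡⟨ cong₂ _∨_ (cong₂ _∧_ (sucMod-≟ i i′) (≟-sym (sucMod j) j′))
                   (cong₂ _∧_ (≟-sym (sucMod i) i′) (sucMod-≟ j j′)) ⟩
    (⌊ i′ ≟ i ⌋ ∧ ⌊ j′ ≟ sucMod j ⌋) ∨ (⌊ i′ ≟ sucMod i ⌋ ∧ ⌊ j′ ≟ j ⌋)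
      ≡⟨ cong₂ _∨_ (combine-≟ i′ i j′ (sucMod j)) (combine-≟ i′ (sucMod i) j′ j) ⟨
    ⌊ combine i′ j′ ≟ combine i (sucMod j) ⌋ ∨ ⌊ combine i′ j′ ≟ combine (sucMod i) j ⌋
      ∎
    where open ≡-Reasoning

  successors-distinct : ∀ (i : Fin n) (j : Fin m) → combine (sucMod i) j ≢ combine i (sucMod j)
  successors-distinct i j = sucMod≢id 1≤n′ i ∘ combine-injectiveˡ (sucMod i) j i (sucMod j)

  outSum-combine : ∀ x (i : Fin n) (j : Fin m) →
                   outSum G x (combine i j) ≡ x (combine (sucMod i) j) ℚ.+ x (combine i (sucMod j))
  outSum-combine x i j = sumFin-pair (successors-distinct i j) (arc G (combine i j)) (arc-from i j) x

  inSum-combine : ∀ x (i : Fin n) (j : Fin m) →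
                  inSum G x (combine (sucMod i) (sucMod j))
                    ≡ x (combine i (sucMod j)) ℚ.+ x (combine (sucMod i) j)
  inSum-combine x i j = sumFin-pair (successors-distinct i j ∘ sym)
                                    (λ u → arc G u (combine (sucMod i) (sucMod j))) (arc-into i j) x

  vertex : ℕ × ℕ → Fin (n * m)
  vertex (a , b) = combine (a mod n) (b mod m)

  coords : Fin (n * m) → ℕ × ℕ
  coords u = map toℕ toℕ (remQuot {n} m u)

  vertex-coords : ∀ u → vertex (coords u) ≡ u
  vertex-coords u =
    trans (cong₂ combine (mod-toℕ (proj₁ (remQuot {n} m u))) (mod-toℕ (proj₂ (remQuot {n} m u))))
          (combine-remQuot {n} m u)

  coords-vertex : ∀ a b → coords (vertex (a , b)) ≡ (a % n , b % m)
  coords-vertex a b = trans (cong (map toℕ toℕ) (remQuot-combine (a mod n) (b mod m)))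
                            (cong₂ _,_ (toℕ-mod a {n}) (toℕ-mod b {m}))

  biperiodic-coords-vertex : ∀ {Y} → Biperiodic n m Y → ∀ p → Y (coords (vertex p)) ≡ Y p
  biperiodic-coords-vertex {Y} (per₁ , per₂) (a , b) =
    trans (cong Y (coords-vertex a b)) (trans (periodic-% (per₁ (b % m)) a) (periodic-% (per₂ a) b))

  vertex-periodic : ∀ a b → vertex (n + a , m + b) ≡ vertex (a , b)
  vertex-periodic a b = cong₂ combine (mod-periodic {n} a) (mod-periodic {m} b)

  biperiodic-vertex : ∀ x → Biperiodic n m (x ∘ vertex)
  biperiodic-vertex x = (λ b a → cong (λ i → x (combine i (b mod m))) (mod-periodic {n} a)) ,
                        (λ a b → cong (λ j → x (combine (a mod n) j)) (mod-periodic {m} b))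

  vertex-sucˡ : ∀ a b → combine (sucMod (a mod n)) (b mod m) ≡ vertex (suc a , b)
  vertex-sucˡ a b = cong (λ i → combine i (b mod m)) (sucMod-mod {n′} a)

  vertex-sucʳ : ∀ a b → combine (a mod n) (sucMod (b mod m)) ≡ vertex (a , suc b)
  vertex-sucʳ a b = cong (combine (a mod n)) (sucMod-mod {m′} b)

  outSum-vertex : ∀ x a b → outSum G x (vertex (a , b)) ≡ x (vertex (suc a , b)) ℚ.+ x (vertex (a , suc b))
  outSum-vertex x a b = trans (outSum-combine x (a mod n) (b mod m))
                              (cong₂ ℚ._+_ (cong x (vertex-sucˡ a b)) (cong x (vertex-sucʳ a b)))

  inSum-vertex : ∀ x a b → inSum G x (vertex (suc a , suc b)) ≡ x (vertex (a , suc b)) ℚ.+ x (vertex (suc a , b))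
  inSum-vertex x a b = begin
    inSum G x (vertex (suc a , suc b))
      ≡⟨ cong (inSum G x) (cong₂ combine (sucMod-mod {n′} a) (sucMod-mod {m′} b)) ⟨
    inSum G x (combine (sucMod (a mod n)) (sucMod (b mod m)))
      ≡⟨ inSum-combine x (a mod n) (b mod m) ⟩
    x (combine (a mod n) (sucMod (b mod m))) ℚ.+ x (combine (sucMod (a mod n)) (b mod m))
      ≡⟨ cong₂ ℚ._+_ (cong x (vertex-sucʳ a b)) (cong x (vertex-sucˡ a b)) ⟩
    x (vertex (a , suc b)) ℚ.+ x (vertex (suc a , b))
      ∎
    where open ≡-Reasoning

  inKer⇔kernelEq : ∀ x → InKer G x ⇔ KernelEq (x ∘ vertex)
  inKer⇔kernelEq x = mk⇔
    (λ ker a b → trans (sym (outSum-vertex x a b)) (ker (vertex (a , b))))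
    (λ K u → let (a , b) = coords u in
      subst (λ v → outSum G x v ≡ 0ℚ) (vertex-coords u) (trans (outSum-vertex x a b) (K a b)))

  inCoKer⇔kernelEq : ∀ x → InCoKer G x ⇔ KernelEq (x ∘ vertex)
  inCoKer⇔kernelEq x = mk⇔ to from
    where
    swapped : ∀ a b → inSum G x (vertex (suc a , suc b)) ≡ x (vertex (suc a , b)) ℚ.+ x (vertex (a , suc b))
    swapped a b = trans (inSum-vertex x a b) (QP.+-comm (x (vertex (a , suc b))) (x (vertex (suc a , b))))
    to : InCoKer G x → KernelEq (x ∘ vertex)
    to coker a b = trans (sym (swapped a b)) (coker (vertex (suc a , suc b)))
    -- suc (n′ + a) = n + a, so every vertex is of the form vertex (suc a′ , suc b′)
    from : KernelEq (x ∘ vertex) → InCoKer G x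
    from K u = let (a , b) = coords u in
      subst (λ v → inSum G x v ≡ 0ℚ) (trans (vertex-periodic a b) (vertex-coords u))
            (trans (swapped (n′ + a) (m′ + b)) (K (n′ + a) (m′ + b)))

  inKer⇔inCoKer : ∀ x → InKer G x ⇔ InCoKer G x
  inKer⇔inCoKer x = ⇔-sym (inCoKer⇔kernelEq x) ⇔-∘ inKer⇔kernelEq x

  dextroNut⇔gridNut : DextroNut G ⇔ NutSpace (ℕ × ℕ) (GridKer n m)
  dextroNut⇔gridNut = NutSpace-transfer vertex coords vertex-coords
    (λ x ker → Equivalence.to (inKer⇔kernelEq x) ker , biperiodic-vertex x)
    (λ Y (KY , perY) → Equivalence.from (inKer⇔kernelEq (Y ∘ coords))
                         (kernelEq-cong (sym ∘ biperiodic-coords-vertex perY) KY))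
    (λ Y (_ , perY) → biperiodic-coords-vertex perY)

module _ (G : Digraph) (ker⇔coker : ∀ x → InKer G x ⇔ InCoKer G x) where

  dextroNut⇔laevoNut : DextroNut G ⇔ LaevoNut G
  dextroNut⇔laevoNut = NutSpace-cong ker⇔coker

  dextroNut⇔ambiNut : DextroNut G ⇔ AmbiNut G
  dextroNut⇔ambiNut = mk⇔
    (λ (x , full , x-spans) → x , full , x-spans , spans-cong ker⇔coker x-spans)
    (λ (x , full , x-spans , _) → x , full , x-spans)

proposition9 : (n m : ℕ) → 3 ≤ n → 3 ≤ m →
  (DextroNut (torus n m) ⇔ LaevoNut (torus n m))
  × (DextroNut (torus n m) ⇔ AmbiNut (torus n m))
  × (DextroNut (torus n m) ⇔ (2 ∣ m * n × gcd m n ≡ 1))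
proposition9 (suc n′) (suc m′) 3≤n _ =
  dextroNut⇔laevoNut G inKer⇔inCoKer ,
  dextroNut⇔ambiNut G inKer⇔inCoKer ,
  gridNut⇔even-coprime ⇔-∘ dextroNut⇔gridNut
  where open Torus n′ m′ (NP.<⇒≤ (NP.≤-pred 3≤n))
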